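{- Let $G_B$ be a boundaried graph, $F:=V(G)\setminus B$, such that no vertex of $F$ is isolated in $G$, $G$ contains no crown $(I,H)$ with $I\subseteq F$ having an $H$-saturating matching $M_0$ with $M_0\subsetneq E(I,H)$, and $G-B$ is bipartite with bipartition $(L,R)$ and has a perfect matching $M$. Suppose $x\in B$ is such that there are more than $|B|$ edges $\{u,v\}\in M$ with both $u$ and $v$ adjacent to $x$ (i.e., $(u,v,x)$ forms a triangle). Let $G'$ be obtained from $G$ by removing all edges between $x$ and $F$, adding a new vertex $l_x\notin B$, and adding the edge $\{x,l_x\}$. Then for every boundaried graph $H_B$ with $V(H)\cap V(G)=V(H)\cap V(G')=B$, $\mathrm{OPT}_{\mathrm{VC}}(G_B\oplus H_B)=\mathrm{OPT}_{\mathrm{VC}}(G'_B\oplus H_B)$.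
   Context: All graphs finite, simple, undirected. $G_B\oplus H_B$ (for $V(G)\cap V(H)=B$) has vertex set $V(G)\cup V(H)$ and edge set $E(G)\cup E(H)$. $\mathrm{OPT}_{\mathrm{VC}}$ denotes the minimum size of a vertex cover. A crown in $G$ is a pair $(I,H)$ of disjoint vertex sets with $I$ independent, $H=N_G(I)$, and a matching between $I$ and $H$ saturating $H$; $E(I,H)$ denotes the set of edges between $I$ and $H$. -}

module Defs where

open import Data.Nat using (ℕ; _≤_; _<_; _≟_)
open import Data.List using (List; _∷_; []; _++_; length; concatMap)
open import Data.List.Membership.Propositional using (_∈_; _∉_)
open import Data.List.Membership.Propositional.Properties using (∈-++⁺ˡ; ∈-++⁺ʳ)
open import Data.List.Membership.DecPropositional _≟_ using (_∈?_)
open import Data.List.Relation.Unary.All using (All)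
open import Data.List.Relation.Unary.Any using (here; there)
open import Data.List.Relation.Unary.Unique.Propositional using (Unique)
open import Data.Product using (Σ; ∃; _×_; _,_; proj₁; proj₂)
open import Data.Sum using (_⊎_; inj₁; inj₂)
open import Relation.Nullary using (¬_; Dec)
open import Relation.Nullary.Decidable using (_×-dec_; _⊎-dec_; ¬?)
open import Relation.Binary.PropositionalEquality using (_≡_; _≢_; refl; sym; subst)
open import Function.Bundles using (_⇔_)

record Graph : Set₁ where
  field
    V      : List ℕ
    Adj    : ℕ → ℕ → Set
    adj?   : ∀ u v → Dec (Adj u v)
    adjSym : ∀ {u v} → Adj u v → Adj v u
    irrefl : ∀ {u v} → Adj u v → u ≢ v
    adjV   : ∀ {u v} → Adj u v → u ∈ V

open Graph public

_⊕_ : Graph → Graph → Graph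
G ⊕ H = record
  { V      = V G ++ V H
  ; Adj    = λ u v → Adj G u v ⊎ Adj H u v
  ; adj?   = λ u v → adj? G u v ⊎-dec adj? H u v
  ; adjSym = λ { (inj₁ a) → inj₁ (adjSym G a) ; (inj₂ a) → inj₂ (adjSym H a) }
  ; irrefl = λ { (inj₁ a) → irrefl G a ; (inj₂ a) → irrefl H a }
  ; adjV   = λ { (inj₁ a) → ∈-++⁺ˡ (adjV G a) ; (inj₂ a) → ∈-++⁺ʳ (V G) (adjV H a) }
  }

InF : Graph → List ℕ → ℕ → Set
InF G B v = v ∈ V G × v ∉ B

InF? : (G : Graph) (B : List ℕ) → ∀ v → Dec (InF G B v)
InF? G B v = (v ∈? V G) ×-dec ¬? (v ∈? B)

module Modify (G : Graph) (B : List ℕ) (x lx : ℕ)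
              (x∈V : x ∈ V G) (lx∉V : lx ∉ V G) where

  XF : ℕ → ℕ → Set
  XF u v = (u ≡ x × InF G B v) ⊎ (v ≡ x × InF G B u)

  XF? : ∀ u v → Dec (XF u v)
  XF? u v = ((u ≟ x) ×-dec InF? G B v) ⊎-dec ((v ≟ x) ×-dec InF? G B u)

  XF-sym : ∀ {u v} → XF u v → XF v u
  XF-sym (inj₁ p) = inj₂ p
  XF-sym (inj₂ p) = inj₁ p

  Adj' : ℕ → ℕ → Set
  Adj' u v = (Adj G u v × ¬ XF u v) ⊎ ((u ≡ x × v ≡ lx) ⊎ (u ≡ lx × v ≡ x))

  x≢lx : x ≢ lx
  x≢lx e = lx∉V (subst (_∈ V G) e x∈V)

  G' : Graph
  G' = record
    { V      = lx ∷ V G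
    ; Adj    = Adj'
    ; adj?   = λ u v → (adj? G u v ×-dec ¬? (XF? u v))
                        ⊎-dec (((u ≟ x) ×-dec (v ≟ lx)) ⊎-dec ((u ≟ lx) ×-dec (v ≟ x)))
    ; adjSym = λ { (inj₁ (a , n)) → inj₁ (adjSym G a , λ q → n (XF-sym q))
                 ; (inj₂ (inj₁ (p , q))) → inj₂ (inj₂ (q , p))
                 ; (inj₂ (inj₂ (p , q))) → inj₂ (inj₁ (q , p)) }
    ; irrefl = λ { (inj₁ (a , _)) → irrefl G a
                 ; (inj₂ (inj₁ (refl , refl))) → x≢lx
                 ; (inj₂ (inj₂ (refl , refl))) e → x≢lx (sym e) }
    ; adjV   = λ { (inj₁ (a , _)) → there (adjV G a)
                 ; (inj₂ (inj₁ (refl , _))) → there x∈V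
                 ; (inj₂ (inj₂ (refl , _))) → here refl }
    }

-- Vertex covers and OPT_VC.  Vertex sets are duplicate-free lists.

IsVC : Graph → List ℕ → Set
IsVC G C = All (_∈ V G) C × (∀ {u v} → Adj G u v → u ∈ C ⊎ v ∈ C)

IsOptVC : Graph → ℕ → Set
IsOptVC G k =
  (Σ (List ℕ) λ C → IsVC G C × Unique C × length C ≡ k)
  × (∀ C → IsVC G C → Unique C → k ≤ length C)

Ends : List (ℕ × ℕ) → List ℕ
Ends M = concatMap (λ e → proj₁ e ∷ proj₂ e ∷ []) M

IsMatching : Graph → List (ℕ × ℕ) → Set
IsMatching G M = All (λ e → Adj G (proj₁ e) (proj₂ e)) M × Unique (Ends M)

MatchingBetween : Graph → List ℕ → List ℕ → List (ℕ × ℕ) → Set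
MatchingBetween G I H M =
  IsMatching G M × All (λ e → proj₁ e ∈ I × proj₂ e ∈ H) M

Saturates : List (ℕ × ℕ) → List ℕ → Set
Saturates M S = ∀ {v} → v ∈ S → v ∈ Ends M

Independent : Graph → List ℕ → Set
Independent G I = ∀ {u v} → u ∈ I → v ∈ I → ¬ Adj G u v

IsCrown : Graph → List ℕ → List ℕ → Set
IsCrown G I H =
  All (_∈ V G) I × All (_∈ V G) H
  × (∀ {v} → v ∈ I → v ∉ H)
  × Independent G I
  × (∀ v → v ∈ H ⇔ (∃ λ u → u ∈ I × Adj G u v))
  × (Σ (List (ℕ × ℕ)) λ M → MatchingBetween G I H M × Saturates M H)

-- M0 ⊊ E(I,H): some edge of E(I,H) is not in M0 (M0 ⊆ E(I,H) is part
-- of MatchingBetween)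
StrictInEIH : Graph → List ℕ → List ℕ → List (ℕ × ℕ) → Set
StrictInEIH G I H M0 =
  ∃ λ u → ∃ λ v → u ∈ I × v ∈ H × Adj G u v × (u , v) ∉ M0

NoStrictCrown : Graph → List ℕ → Set
NoStrictCrown G B =
  ¬ (Σ (List ℕ) λ I → Σ (List ℕ) λ H → Σ (List (ℕ × ℕ)) λ M0 →
       IsCrown G I H × All (InF G B) I
       × MatchingBetween G I H M0 × Saturates M0 H × StrictInEIH G I H M0)

NoIsolatedInF : Graph → List ℕ → Set
NoIsolatedInF G B = ∀ v → InF G B v → ∃ λ u → Adj G v u

IsBipartition : Graph → List ℕ → List ℕ → List ℕ → Set
IsBipartition G B L R =
  (∀ v → InF G B v ⇔ (v ∈ L ⊎ v ∈ R))
  × (∀ {v} → v ∈ L → v ∉ R)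
  × (∀ {u v} → u ∈ L → v ∈ L → ¬ Adj G u v)
  × (∀ {u v} → u ∈ R → v ∈ R → ¬ Adj G u v)

IsPerfectMatchingMinusB : Graph → List ℕ → List (ℕ × ℕ) → Set
IsPerfectMatchingMinusB G B M =
  IsMatching G M
  × All (λ e → InF G B (proj₁ e) × InF G B (proj₂ e)) M
  × (∀ v → InF G B v → v ∈ Ends M)

ManyTriangles : Graph → List ℕ → List (ℕ × ℕ) → ℕ → Set
ManyTriangles G B M x =
  Σ (List (ℕ × ℕ)) λ T →
    Unique T × All (_∈ M) T
    × All (λ e → Adj G x (proj₁ e) × Adj G x (proj₂ e)) T
    × length B < length T

-- Both sides are compared through transfers of vertex covers that never grow.
-- A cover of G' ⊕ H must take x or l_x; replacing l_x by x and restoring the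
-- edges between x and F gives a cover of G ⊕ H. Conversely a cover C of
-- G ⊕ H that contains x is already a cover of G' ⊕ H. If x ∉ C, then C
-- takes one end of every edge of M and both ends of the more than |B|
-- triangle edges, so |C ∩ F| ≥ |M| + |B| + 1. Trading C ∩ F for B together
-- with the L-ends of M (which are all of L, as M is perfect) is then no
-- more expensive, and by bipartiteness still covers every edge of G - B.
module Submission where

open import Defs
open import Data.Nat using (ℕ; suc; _+_; _≤_; _<_; _≟_; z≤n; s≤s)
open import Data.Nat.Properties
  using (≤-refl; ≤-reflexive; ≤-trans; ≤-antisym; <⇒≤; m≤n⇒m≤1+n; +-suc; +-comm; +-monoʳ-≤; +-mono-≤;
         module ≤-Reasoning)
open import Data.List using (List; _∷_; []; _++_; length; filter; deduplicate)
open import Data.List.Properties using (filter-notAll; length-++; length-deduplicate)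
open import Data.List.Membership.Propositional using (_∈_; _∉_)
open import Data.List.Membership.Propositional.Properties
  using (∈-filter⁺; ∈-filter⁻; ∈-++⁺ˡ; ∈-++⁺ʳ; ∈-++⁻; ∈-deduplicate⁺; ∈-deduplicate⁻)
open import Data.List.Membership.DecPropositional _≟_ using (_∈?_)
open import Data.List.Relation.Binary.Subset.Propositional using (_⊆_)
open import Data.List.Relation.Unary.All as All using (All; _∷_; []; lookup)
open import Data.List.Relation.Unary.Any as Any using (here; there)
open import Data.List.Relation.Unary.Unique.Propositional using (Unique; _∷_)
open import Data.List.Relation.Unary.Unique.Propositional.Properties using (filter⁺)
open import Data.List.Relation.Unary.Unique.DecPropositional.Properties _≟_ using (deduplicate-!)
open import Data.Product using (Σ; _×_; _,_; proj₁; proj₂)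
open import Data.Product.Properties using (≡-dec)
open import Data.Sum using (_⊎_; inj₁; inj₂)
open import Data.Empty using (⊥-elim)
open import Function.Bundles using (_⇔_; mk⇔; Equivalence)
open import Relation.Nullary using (¬_; yes; no; ¬?)
open import Relation.Nullary.Decidable using (_×-dec_)
open import Relation.Unary using (∁; Decidable)
open import Relation.Unary.Properties using (∁?)
open import Relation.Binary.Definitions using (DecidableEquality)
open import Relation.Binary.PropositionalEquality using (_≡_; refl; sym; trans; cong; ≢-sym)

module _ {A : Set} (_≟ᴬ_ : DecidableEquality A) where

  Unique-⊆⇒length-≤ : ∀ {xs ys : List A} → Unique xs → xs ⊆ ys → length xs ≤ length ys
  Unique-⊆⇒length-≤ {[]} _ _ = z≤n
  Unique-⊆⇒length-≤ {a ∷ xs} {ys} (a∉xs ∷ xs!) a∷xs⊆ys = begin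
    suc (length xs)                  ≤⟨ s≤s (Unique-⊆⇒length-≤ xs! xs⊆ys-a) ⟩
    suc (length (filter ≢a? ys))     ≤⟨ filter-notAll ≢a? ys (Any.map (λ a≡y y≢a → y≢a (sym a≡y)) a∈ys) ⟩
    length ys                        ∎
    where
    open ≤-Reasoning
    ≢a? : Decidable (λ y → ¬ y ≡ a)
    ≢a? y = ¬? (y ≟ᴬ a)
    a∈ys : a ∈ ys
    a∈ys = a∷xs⊆ys (here refl)
    xs⊆ys-a : xs ⊆ filter ≢a? ys
    xs⊆ys-a z∈xs = ∈-filter⁺ ≢a? (a∷xs⊆ys (there z∈xs)) (≢-sym (lookup a∉xs z∈xs))

length-filter+filter-∁ : ∀ {A : Set} {P : A → Set} (P? : Decidable P) xs →
                         length (filter P? xs) + length (filter (∁? P?) xs) ≡ length xs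
length-filter+filter-∁ P? [] = refl
length-filter+filter-∁ P? (a ∷ xs) with P? a
... | yes _ = cong suc (length-filter+filter-∁ P? xs)
... | no _  = trans (+-suc _ _) (cong suc (length-filter+filter-∁ P? xs))

All-Ends : ∀ {P : ℕ → Set} {M} → All (λ e → P (proj₁ e) × P (proj₂ e)) M → ∀ {z} → z ∈ Ends M → P z
All-Ends ((pa , _) ∷ _) (here refl)         = pa
All-Ends ((_ , pb) ∷ _) (there (here refl)) = pb
All-Ends (_ ∷ pM)       (there (there z∈M)) = All-Ends pM z∈M

module _ {P : ℕ → Set} (P? : Decidable P) where

  BothEnds : ℕ × ℕ → Set
  BothEnds e = P (proj₁ e) × P (proj₂ e)

  bothEnds? : Decidable BothEnds
  bothEnds? e = P? (proj₁ e) ×-dec P? (proj₂ e)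

  length-filter-Ends-≤ : ∀ {M} → All (∁ BothEnds) M → length (filter P? (Ends M)) ≤ length M
  length-filter-Ends-≤ {[]} [] = z≤n
  length-filter-Ends-≤ {(a , b) ∷ M} (¬ab ∷ rest) with P? a
  ... | yes pa with P? b
  ...   | yes pb = ⊥-elim (¬ab (pa , pb))
  ...   | no _   = s≤s (length-filter-Ends-≤ rest)
  length-filter-Ends-≤ {(a , b) ∷ M} (¬ab ∷ rest) | no _ with P? b
  ...   | yes _  = s≤s (length-filter-Ends-≤ rest)
  ...   | no _   = m≤n⇒m≤1+n (length-filter-Ends-≤ rest)

  length-filter-Ends-≥ : ∀ {M} → All (λ e → P (proj₁ e) ⊎ P (proj₂ e)) M →
                         length M + length (filter bothEnds? M) ≤ length (filter P? (Ends M))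
  length-filter-Ends-≥ {[]} [] = z≤n
  length-filter-Ends-≥ {(a , b) ∷ M} (a∨b ∷ rest) with P? a
  ... | yes _ with P? b
  ...   | yes _ = s≤s (≤-trans (≤-reflexive (+-suc _ _)) (s≤s (length-filter-Ends-≥ rest)))
  ...   | no _  = s≤s (length-filter-Ends-≥ rest)
  length-filter-Ends-≥ {(a , b) ∷ M} (a∨b ∷ rest) | no ¬a with P? b | a∨b
  ...   | yes _  | _       = s≤s (length-filter-Ends-≥ rest)
  ...   | no _   | inj₁ pa = ⊥-elim (¬a pa)
  ...   | no ¬b  | inj₂ pb = ⊥-elim (¬b pb)

CoverTransfer : Graph → Graph → Set
CoverTransfer G₁ G₂ =
  ∀ C → IsVC G₁ C → Unique C → Σ (List ℕ) λ C₂ → IsVC G₂ C₂ × Unique C₂ × length C₂ ≤ length C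

isOptVC-transfer : ∀ {G₁ G₂} → CoverTransfer G₁ G₂ → CoverTransfer G₂ G₁ →
                   ∀ {k} → IsOptVC G₁ k → IsOptVC G₂ k
isOptVC-transfer {G₂ = G₂} to from {k} ((C , C-cover , C! , |C|≡k) , k-min) with to C C-cover C!
... | C₂ , C₂-cover , C₂! , |C₂|≤|C| =
  (C₂ , C₂-cover , C₂! , ≤-antisym (≤-trans |C₂|≤|C| (≤-reflexive |C|≡k)) (k≤ C₂ C₂-cover C₂!)) , k≤
  where
  k≤ : ∀ D → IsVC G₂ D → Unique D → k ≤ length D
  k≤ D D-cover D! with from D D-cover D!
  ... | D₁ , D₁-cover , D₁! , |D₁|≤|D| = ≤-trans (k-min D₁ D₁-cover D₁!) |D₁|≤|D|

module Pendant (G H : Graph) (B : List ℕ) (x lx : ℕ)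
               (x∈V : x ∈ V G) (lx∉V : lx ∉ V G) (lx∉VH : lx ∉ V H) where

  open Modify G B x lx x∈V lx∉V

  cover-through-x⇒cover-G' : ∀ {C} → IsVC (G ⊕ H) C → x ∈ C → IsVC (G' ⊕ H) C
  cover-through-x⇒cover-G' (C⊆V , covers) x∈C = All.map there C⊆V , covers'
    where
    covers' : ∀ {u v} → Adj (G' ⊕ H) u v → u ∈ _ ⊎ v ∈ _
    covers' (inj₁ (inj₁ (uv , _)))               = covers (inj₁ uv)
    covers' (inj₁ (inj₂ (inj₁ (refl , refl)))) = inj₁ x∈C
    covers' (inj₁ (inj₂ (inj₂ (refl , refl)))) = inj₂ x∈C
    covers' (inj₂ uv)                            = covers (inj₂ uv)

  transfer-from-G' : CoverTransfer (G' ⊕ H) (G ⊕ H)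
  transfer-from-G' D (D⊆V , covers) D! = x ∷ D⁻ , (∈-++⁺ˡ x∈V ∷ D⁻⊆V , covers') , x∷D⁻! , size
    where
    other? : Decidable (λ v → ¬ v ≡ x × ¬ v ≡ lx)
    other? v = ¬? (v ≟ x) ×-dec ¬? (v ≟ lx)
    D⁻ = filter other? D
    x∷D⁻! : Unique (x ∷ D⁻)
    x∷D⁻! = All.tabulate (λ v∈D⁻ x≡v → proj₁ (proj₂ (∈-filter⁻ other? {xs = D} v∈D⁻)) (sym x≡v))
          ∷ filter⁺ other? D!
    size : suc (length D⁻) ≤ length D
    size with covers (inj₁ (inj₂ (inj₁ (refl , refl))))
    ... | inj₁ x∈D  = filter-notAll other? D (Any.map (λ x≡v other → proj₁ other (sym x≡v)) x∈D)
    ... | inj₂ lx∈D = filter-notAll other? D (Any.map (λ lx≡v other → proj₂ other (sym lx≡v)) lx∈D)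
    in-V : ∀ {v} → v ∈ D → ¬ v ≡ lx → v ∈ V (G ⊕ H)
    in-V v∈D v≢lx with lookup D⊆V v∈D
    ... | here v≡lx = ⊥-elim (v≢lx v≡lx)
    ... | there v∈V = v∈V
    D⁻⊆V : All (_∈ V (G ⊕ H)) D⁻
    D⁻⊆V = All.tabulate λ v∈D⁻ → let (v∈D , _ , v≢lx) = ∈-filter⁻ other? {xs = D} v∈D⁻ in in-V v∈D v≢lx
    keep : ∀ {v} → v ∈ D → ¬ v ≡ lx → v ∈ x ∷ D⁻
    keep {v} v∈D v≢lx with v ≟ x
    ... | yes v≡x = here v≡x
    ... | no v≢x  = there (∈-filter⁺ other? v∈D (v≢x , v≢lx))
    ≢lx-G : ∀ {v} → v ∈ V G → ¬ v ≡ lx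
    ≢lx-G v∈V refl = lx∉V v∈V
    ≢lx-H : ∀ {v} → v ∈ V H → ¬ v ≡ lx
    ≢lx-H v∈V refl = lx∉VH v∈V
    covers' : ∀ {u v} → Adj (G ⊕ H) u v → u ∈ x ∷ D⁻ ⊎ v ∈ x ∷ D⁻
    covers' {u} {v} (inj₁ uv) with XF? u v
    ... | yes (inj₁ (u≡x , _)) = inj₁ (here u≡x)
    ... | yes (inj₂ (v≡x , _)) = inj₂ (here v≡x)
    ... | no ¬XF with covers (inj₁ (inj₁ (uv , ¬XF)))
    ...   | inj₁ u∈D = inj₁ (keep u∈D (≢lx-G (adjV G uv)))
    ...   | inj₂ v∈D = inj₂ (keep v∈D (≢lx-G (adjV G (adjSym G uv))))
    covers' (inj₂ uv) with covers (inj₂ uv)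
    ... | inj₁ u∈D = inj₁ (keep u∈D (≢lx-H (adjV H uv)))
    ... | inj₂ v∈D = inj₂ (keep v∈D (≢lx-H (adjV H (adjSym H uv))))

module Exchange
  (G H : Graph) (B : List ℕ) (B⊆V : All (_∈ V G) B)
  (H∩G⊆B : ∀ {v} → v ∈ V G → v ∈ V H → v ∈ B)
  (L R : List ℕ) (F⊆L∪R : ∀ {v} → InF G B v → v ∈ L ⊎ v ∈ R)
  (L-indep : ∀ {u v} → u ∈ L → v ∈ L → ¬ Adj G u v)
  (R-indep : ∀ {u v} → u ∈ R → v ∈ R → ¬ Adj G u v)
  (M : List (ℕ × ℕ)) (M-edges : All (λ e → Adj G (proj₁ e) (proj₂ e)) M) (Ends-M! : Unique (Ends M))
  (M⊆F : All (λ e → InF G B (proj₁ e) × InF G B (proj₂ e)) M) (F⊆Ends-M : ∀ v → InF G B v → v ∈ Ends M)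
  (x : ℕ) (x∈B : x ∈ B)
  (T : List (ℕ × ℕ)) (T! : Unique T) (T⊆M : All (_∈ M) T)
  (T-triangles : All (λ e → Adj G x (proj₁ e) × Adj G x (proj₂ e)) T) (|B|<|T| : length B < length T)
  where

  L-ends : List ℕ
  L-ends = filter (_∈? L) (Ends M)

  outsideF? : Decidable (∁ (InF G B))
  outsideF? = ∁? (InF? G B)

  exchanged : List ℕ → List ℕ
  exchanged C = deduplicate _≟_ (filter outsideF? C ++ B ++ L-ends)

  module _ {C : List ℕ} (C-cover : IsVC (G ⊕ H) C) where

    private
      C∖F : List ℕ
      C∖F = filter outsideF? C

      in-exchanged : ∀ {v} → v ∈ C∖F ++ B ++ L-ends → v ∈ exchanged C
      in-exchanged = ∈-deduplicate⁺ _≟_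

      in-exchangedᴮ : ∀ {v} → v ∈ B → v ∈ exchanged C
      in-exchangedᴮ v∈B = in-exchanged (∈-++⁺ʳ C∖F (∈-++⁺ˡ v∈B))

      in-exchangedᴸ : ∀ {v} → v ∈ L → InF G B v → v ∈ exchanged C
      in-exchangedᴸ v∈L v∈F = in-exchanged (∈-++⁺ʳ C∖F (∈-++⁺ʳ B (∈-filter⁺ (_∈? L) (F⊆Ends-M _ v∈F) v∈L)))

      in-exchangedᶜ : ∀ {v} → v ∈ C → ¬ InF G B v → v ∈ exchanged C
      in-exchangedᶜ v∈C v∉F = in-exchanged (∈-++⁺ˡ (∈-filter⁺ outsideF? v∈C v∉F))

      H-outsideF : ∀ {v} → v ∈ V H → ¬ InF G B v
      H-outsideF v∈VH (v∈VG , v∉B) = v∉B (H∩G⊆B v∈VG v∈VH)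

    x∈exchanged : x ∈ exchanged C
    x∈exchanged = in-exchangedᴮ x∈B

    exchanged⊆V : All (_∈ V (G ⊕ H)) (exchanged C)
    exchanged⊆V = All.tabulate λ v∈C' → in-V (∈-++⁻ C∖F (∈-deduplicate⁻ _≟_ (C∖F ++ B ++ L-ends) v∈C'))
      where
      in-V : ∀ {v} → v ∈ C∖F ⊎ v ∈ B ++ L-ends → v ∈ V (G ⊕ H)
      in-V (inj₁ v∈C∖F) = lookup (proj₁ C-cover) (proj₁ (∈-filter⁻ outsideF? v∈C∖F))
      in-V (inj₂ v∈B++L-ends) with ∈-++⁻ B v∈B++L-ends
      ... | inj₁ v∈B      = ∈-++⁺ˡ (lookup B⊆V v∈B)
      ... | inj₂ v∈L-ends = ∈-++⁺ˡ (proj₁ (All-Ends M⊆F (proj₁ (∈-filter⁻ (_∈? L) v∈L-ends))))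

    -- An edge of G missing B lies in G - B, so one of its ends is in L and hence in L-ends.
    exchanged-covers : ∀ {u v} → Adj (G ⊕ H) u v → u ∈ exchanged C ⊎ v ∈ exchanged C
    exchanged-covers (inj₂ uv) with proj₂ C-cover (inj₂ uv)
    ... | inj₁ u∈C = inj₁ (in-exchangedᶜ u∈C (H-outsideF (adjV H uv)))
    ... | inj₂ v∈C = inj₂ (in-exchangedᶜ v∈C (H-outsideF (adjV H (adjSym H uv))))
    exchanged-covers {u} {v} (inj₁ uv) with u ∈? B | v ∈? B
    ... | yes u∈B | _       = inj₁ (in-exchangedᴮ u∈B)
    ... | no _    | yes v∈B = inj₂ (in-exchangedᴮ v∈B)
    ... | no u∉B  | no v∉B  with F⊆L∪R (adjV G uv , u∉B) | F⊆L∪R (adjV G (adjSym G uv) , v∉B)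
    ...   | inj₁ u∈L | _        = inj₁ (in-exchangedᴸ u∈L (adjV G uv , u∉B))
    ...   | inj₂ _   | inj₁ v∈L = inj₂ (in-exchangedᴸ v∈L (adjV G (adjSym G uv) , v∉B))
    ...   | inj₂ u∈R | inj₂ v∈R = ⊥-elim (R-indep u∈R v∈R uv)

    |B|+|L-ends|≤|C∩F| : x ∉ C → length B + length L-ends ≤ length (filter (InF? G B) C)
    |B|+|L-ends|≤|C∩F| x∉C = begin
      length B + length L-ends                         ≤⟨ +-mono-≤ (<⇒≤ |B|<|T|) L-ends≤M ⟩
      length T + length M                              ≡⟨ +-comm (length T) (length M) ⟩
      length M + length T                              ≤⟨ +-monoʳ-≤ (length M) T≤doubly-covered ⟩
      length M + length (filter (bothEnds? (_∈? C)) M) ≤⟨ length-filter-Ends-≥ (_∈? C) M-covered ⟩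
      length (filter (_∈? C) (Ends M))                 ≤⟨ Unique-⊆⇒length-≤ _≟_ (filter⁺ (_∈? C) Ends-M!) C∩Ends-M⊆C∩F ⟩
      length (filter (InF? G B) C)                     ∎
      where
      open ≤-Reasoning
      M-covered : All (λ e → proj₁ e ∈ C ⊎ proj₂ e ∈ C) M
      M-covered = All.map (λ uv → proj₂ C-cover (inj₁ uv)) M-edges
      L-ends≤M : length L-ends ≤ length M
      L-ends≤M = length-filter-Ends-≤ (_∈? L) (All.map (λ uv (u∈L , v∈L) → L-indep u∈L v∈L uv) M-edges)
      other-end : ∀ {w} → x ∈ C ⊎ w ∈ C → w ∈ C
      other-end (inj₁ x∈C) = ⊥-elim (x∉C x∈C)
      other-end (inj₂ w∈C) = w∈C
      T≤doubly-covered : length T ≤ length (filter (bothEnds? (_∈? C)) M)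
      T≤doubly-covered = Unique-⊆⇒length-≤ (≡-dec _≟_ _≟_) T! λ e∈T →
        let (xu , xv) = lookup T-triangles e∈T in
        ∈-filter⁺ (bothEnds? (_∈? C)) (lookup T⊆M e∈T)
          (other-end (proj₂ C-cover (inj₁ xu)) , other-end (proj₂ C-cover (inj₁ xv)))
      C∩Ends-M⊆C∩F : filter (_∈? C) (Ends M) ⊆ filter (InF? G B) C
      C∩Ends-M⊆C∩F v∈C∩Ends = let (v∈Ends , v∈C) = ∈-filter⁻ (_∈? C) v∈C∩Ends in
        ∈-filter⁺ (InF? G B) v∈C (All-Ends M⊆F v∈Ends)

    length-exchanged : x ∉ C → length (exchanged C) ≤ length C
    length-exchanged x∉C = begin
      length (exchanged C)                                        ≤⟨ length-deduplicate _≟_ (C∖F ++ B ++ L-ends) ⟩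
      length (C∖F ++ B ++ L-ends)                                 ≡⟨ length-++ C∖F ⟩
      length C∖F + length (B ++ L-ends)                           ≡⟨ cong (length C∖F +_) (length-++ B) ⟩
      length C∖F + (length B + length L-ends)                     ≤⟨ +-monoʳ-≤ (length C∖F) (|B|+|L-ends|≤|C∩F| x∉C) ⟩
      length C∖F + length (filter (InF? G B) C)                   ≡⟨ +-comm (length C∖F) _ ⟩
      length (filter (InF? G B) C) + length C∖F                   ≡⟨ length-filter+filter-∁ (InF? G B) C ⟩
      length C                                                    ∎
      where
      open ≤-Reasoning

  cover-through-x : ∀ C → IsVC (G ⊕ H) C → Unique C →
                    Σ (List ℕ) λ C' → IsVC (G ⊕ H) C' × x ∈ C' × Unique C' × length C' ≤ length C
  cover-through-x C C-cover C! with x ∈? C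
  ... | yes x∈C = C , C-cover , x∈C , C! , ≤-refl
  ... | no x∉C  = exchanged C , (exchanged⊆V C-cover , exchanged-covers C-cover) ,
                  x∈exchanged C-cover , deduplicate-! _ , length-exchanged C-cover x∉C

lemma32 : (G : Graph) (B : List ℕ) → Unique B → (B⊆V : All (_∈ V G) B)
    → NoIsolatedInF G B
    → NoStrictCrown G B
    → (L R : List ℕ) → IsBipartition G B L R
    → (M : List (ℕ × ℕ)) → IsPerfectMatchingMinusB G B M
    → (x : ℕ) (x∈B : x ∈ B) → ManyTriangles G B M x
    → (lx : ℕ) (lx∉V : lx ∉ V G) → lx ∉ B
    → (H : Graph)
    → (∀ v → (v ∈ V G × v ∈ V H) ⇔ v ∈ B)
    → (∀ v → (v ∈ V (Modify.G' G B x lx (lookup B⊆V x∈B) lx∉V) × v ∈ V H) ⇔ v ∈ B)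
    → ∀ k → IsOptVC (G ⊕ H) k ⇔ IsOptVC (Modify.G' G B x lx (lookup B⊆V x∈B) lx∉V ⊕ H) k
lemma32 G B _ B⊆V _ _ L R (F⇔L⊎R , _ , L-indep , R-indep) M ((M-edges , Ends-M!) , M⊆F , F⊆Ends-M)
        x x∈B (T , T! , T⊆M , T-triangles , |B|<|T|) lx lx∉V lx∉B H H∩G H∩G' k =
  mk⇔ (isOptVC-transfer {G ⊕ H} {G' ⊕ H} transfer-to-G' transfer-from-G')
      (isOptVC-transfer {G' ⊕ H} {G ⊕ H} transfer-from-G' transfer-to-G')
  where
  lx∉VH : lx ∉ V H
  lx∉VH lx∈VH = lx∉B (Equivalence.to (H∩G' lx) (here refl , lx∈VH))

  open Pendant G H B x lx (lookup B⊆V x∈B) lx∉V lx∉VH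
  open Modify G B x lx (lookup B⊆V x∈B) lx∉V using (G')
  open Exchange G H B B⊆V (λ {v} v∈VG v∈VH → Equivalence.to (H∩G v) (v∈VG , v∈VH))
                L R (λ {v} → Equivalence.to (F⇔L⊎R v)) L-indep R-indep M M-edges Ends-M! M⊆F F⊆Ends-M
                x x∈B T T! T⊆M T-triangles |B|<|T|

  transfer-to-G' : CoverTransfer (G ⊕ H) (G' ⊕ H)
  transfer-to-G' C C-cover C! with cover-through-x C C-cover C!
  ... | C' , C'-cover , x∈C' , C'! , |C'|≤|C| = C' , cover-through-x⇒cover-G' C'-cover x∈C' , C'! , |C'|≤|C|
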